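{- Let $G$ be an outerplanar graph that is an induced subgraph of a biconnected outerplanar graph $G'$. Then for any cutvertex $v$ of $G$ lying in a nontrivial block $B$ of $G$, at least one of the two boundary edges of $B$ incident to $v$ is an internal edge of $G'$.
   Context: All graphs are finite and simple. An outerplanar graph is considered with a plane embedding in which all vertices lie on the outer face. A boundary edge is an edge incident to the outer face; other edges are internal. A block is a maximal biconnected subgraph; it is nontrivial if it has more than two vertices. The boundary edges of a nontrivial block $B$ are the edges on its outer (Hamiltonian) cycle, so each vertex of $B$ is incident to exactly two boundary edges of $B$. -}

module Defs where

open import Data.Nat using (ℕ; zero; suc)
open import Data.Fin using (Fin; toℕ; inject₁; fromℕ) renaming (zero to fzero; suc to fsuc; _<_ to _<ᶠ_)
open import Data.Fin.Permutation using (Permutation′; _⟨$⟩ʳ_)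
open import Data.Product using (Σ; ∃; _×_; _,_)
open import Data.Sum using (_⊎_)
open import Data.Unit using (⊤)
open import Relation.Nullary using (¬_)
open import Relation.Binary.PropositionalEquality using (_≡_; _≢_)
open import Relation.Binary.Construct.Closure.ReflexiveTransitive using (Star)

-- A finite simple graph whose vertices are a subset of Fin n:
-- V is the vertex set, E the (symmetric, loopless) adjacency relation.
-- Subgraphs of a graph are again described this way.
record SGraph (n : ℕ) : Set₁ where
  field
    V     : Fin n → Set
    E     : Fin n → Fin n → Set
    E-V   : ∀ {x y} → E x y → V x × V y
    E-sym : ∀ {x y} → E x y → E y x
    E-irr : ∀ {x} → ¬ E x x
open SGraph public

_⊆G_ : ∀ {n} → SGraph n → SGraph n → Set
H ⊆G K = (∀ x → V H x → V K x) × (∀ x y → E H x y → E K x y)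

Reach : ∀ {n} → SGraph n → Fin n → Fin n → Set
Reach H = Star (E H)

Connected : ∀ {n} → SGraph n → Set
Connected H = ∀ x y → V H x → V H y → Reach H x y

delete : ∀ {n} → SGraph n → Fin n → SGraph n
delete H v = record
  { V = λ x → V H x × x ≢ v
  ; E = λ x y → E H x y × x ≢ v × y ≢ v
  ; E-V = λ { (e , p , q) → let (a , b) = E-V H e in (a , p) , (b , q) }
  ; E-sym = λ { (e , p , q) → E-sym H e , q , p }
  ; E-irr = λ { (e , _ , _) → E-irr H e }
  }

-- v is a cutvertex of H: removing v disconnects two vertices that were
-- connected in H (i.e. the number of components increases).
IsCutVertex : ∀ {n} → SGraph n → Fin n → Set
IsCutVertex H v = V H v × Σ _ λ x → Σ _ λ y →
  V H x × V H y × x ≢ v × y ≢ v × Reach H x y × ¬ Reach (delete H v) x y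

Biconnected : ∀ {n} → SGraph n → Set
Biconnected H = Connected H × (∀ v → ¬ IsCutVertex H v)

IsBlock : ∀ {n} → SGraph n → SGraph n → Set₁
IsBlock G B = B ⊆G G × Biconnected B ×
  (∀ K → B ⊆G K → K ⊆G G → Biconnected K → K ⊆G B)

Nontrivial : ∀ {n} → SGraph n → Set
Nontrivial B = Σ _ λ x → Σ _ λ y → Σ _ λ z →
  V B x × V B y × V B z × x ≢ y × y ≢ z × x ≢ z

Induced : ∀ {n} → SGraph n → (Fin n → Set) → SGraph n
Induced H S = record
  { V = λ x → S x × V H x
  ; E = λ x y → S x × S y × E H x y
  ; E-V = λ { (sx , sy , e) → let (a , b) = E-V H e in (sx , a) , (sy , b) }
  ; E-sym = λ { (sx , sy , e) → sy , sx , E-sym H e }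
  ; E-irr = λ { (_ , _ , e) → E-irr H e }
  }

-- Outerplanar embedding, combinatorially: a cyclic placement σ of the
-- vertices on a circle (σ maps a vertex to its position) such that no two
-- edges cross as chords.
OuterplanarOrder : ∀ {n} → SGraph n → Permutation′ n → Set
OuterplanarOrder H σ = ∀ a b c d → E H a b → E H c d →
  ¬ ((σ ⟨$⟩ʳ a) <ᶠ (σ ⟨$⟩ʳ c) × (σ ⟨$⟩ʳ c) <ᶠ (σ ⟨$⟩ʳ b) × (σ ⟨$⟩ʳ b) <ᶠ (σ ⟨$⟩ʳ d))

Outerplanar : ∀ {n} → SGraph n → Set
Outerplanar H = Σ (Permutation′ _) λ σ → OuterplanarOrder H σ

Consecutive : ∀ {n} → Permutation′ n → Fin n → Fin n → Set
Consecutive {n} σ a b =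
  let p = toℕ (σ ⟨$⟩ʳ a) ; q = toℕ (σ ⟨$⟩ʳ b) in
  suc p ≡ q ⊎ suc q ≡ p ⊎ (p ≡ 0 × suc q ≡ n) ⊎ (q ≡ 0 × suc p ≡ n)

-- For a biconnected outerplanar graph embedded via σ, the outer face is the
-- Hamiltonian cycle through consecutive positions; an internal edge is an
-- edge that is not a side of this cycle.
InternalEdge : ∀ {n} → SGraph n → Permutation′ n → Fin n → Fin n → Set
InternalEdge H σ a b = E H a b × ¬ Consecutive σ a b

record HamCycle {n : ℕ} (B : SGraph n) (k : ℕ) (cyc : Fin (suc k) → Fin n) : Set where
  field
    inj    : ∀ i j → cyc i ≡ cyc j → i ≡ j
    inV    : ∀ i → V B (cyc i)
    onto   : ∀ x → V B x → ∃ λ i → cyc i ≡ x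
    step   : ∀ (i : Fin k) → E B (cyc (inject₁ i)) (cyc (fsuc i))
    close  : E B (cyc (fromℕ k)) (cyc fzero)

{-# OPTIONS --safe #-}
module Submission where

-- If both boundary edges of B at v were sides of the outer cycle of G′, the neighbours u, w
-- of v on B's cycle would be the two neighbours of v on the circle of G′. The arc of B from
-- u to w avoids v; cutting the circle open at v, it runs from one end of the remaining
-- interval to the other. Every chord of G′ at v ends inside that interval, and since chords
-- of G′ do not cross, the arc passes through the chord's other end. So all neighbours of v lie in
-- one component of G − v, and v is not a cutvertex.

open import Defs
open import Data.Nat using (ℕ; zero; suc; _+_; _≤_; _<_; z≤n; s≤s; _<?_; _≟_)
open import Data.Nat.Properties
open import Data.Fin using (Fin; fromℕ; toℕ; inject₁) renaming (zero to fzero; suc to fsuc; _≟_ to _≟ᶠ_)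
open import Data.Fin.Properties using (toℕ-injective; toℕ<n; injective⇒≤)
open import Data.Fin.Permutation using (Permutation′; _⟨$⟩ʳ_; _⟨$⟩ˡ_; inverseˡ)
open import Data.Product using (∃; ∃₂; _×_; _,_; proj₁; proj₂)
open import Data.Sum using (_⊎_; inj₁; inj₂)
open import Data.Empty using (⊥-elim)
open import Function using (_∘_)
open import Function.Definitions using (Injective)
open import Relation.Nullary using (¬_; yes; no; Dec; contradiction)
open import Relation.Nullary.Decidable using (_⊎-dec_; _×-dec_)
open import Relation.Binary.PropositionalEquality
open import Relation.Binary.Definitions using (tri<; tri≈; tri>)
open import Relation.Binary.Construct.Closure.ReflexiveTransitive using (Star; ε; _◅_; _◅◅_; reverse)

intermediate-value : ∀ {A : Set} {R : A → A → Set} (h : A → ℕ) (t : ℕ) {a b : A} →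
  Star R a b → h a < t → t < h b →
  (∃ λ c → h c ≡ t × Star R a c) ⊎ (∃₂ λ p q → R p q × h p < t × t < h q)
intermediate-value h t ε ha<t t<hb = contradiction (<-trans ha<t t<hb) (<-irrefl refl)
intermediate-value h t {a} (_◅_ {j = c} r rest) ha<t t<hb with <-cmp (h c) t
... | tri≈ _ hc≡t _ = inj₁ (c , hc≡t , r ◅ ε)
... | tri> _ _ t<hc = inj₂ (a , c , r , ha<t , t<hc)
... | tri< hc<t _ _ with intermediate-value h t rest hc<t t<hb
...   | inj₁ (d , hd≡t , prefix) = inj₁ (d , hd≡t , r ◅ prefix)
...   | inj₂ jump = inj₂ jump

chain : ∀ {A : Set} {R : A → A → Set} {m} (f : Fin (suc m) → A) →
  (∀ i → R (f (inject₁ i)) (f (fsuc i))) → Star R (f fzero) (f (fromℕ m))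
chain {m = zero}  f steps = ε
chain {m = suc m} f steps = steps fzero ◅ chain (f ∘ fsuc) (steps ∘ fsuc)

Reach-sym : ∀ {n} (H : SGraph n) {a b} → Reach H a b → Reach H b a
Reach-sym H = reverse (E-sym H)

Induced-⊆ : ∀ {n} (G : SGraph n) (S : Fin n → Set) → Induced G S ⊆G G
Induced-⊆ G S = (λ _ → proj₂) , (λ _ _ → proj₂ ∘ proj₂)

¬Reach-delete-from : ∀ {n} (G : SGraph n) {v b} → b ≢ v → ¬ Reach (delete G v) v b
¬Reach-delete-from G b≢v ε = b≢v refl
¬Reach-delete-from G b≢v ((_ , v≢v , _) ◅ _) = v≢v refl

module _ {n} (G : SGraph n) (v h : Fin n)
         (linked : ∀ {z} → E G z v → Reach (delete G v) z h) where

  private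
    Gv = delete G v

    avoids-v-or-reaches-h : ∀ {a b} → Reach G a b → b ≢ v → Reach Gv a b ⊎ Reach Gv b h
    avoids-v-or-reaches-h ε _ = inj₁ ε
    avoids-v-or-reaches-h {a} (_◅_ {j = c} e rest) b≢v with avoids-v-or-reaches-h rest b≢v
    ... | inj₂ bh = inj₂ bh
    ... | inj₁ cb with c ≟ᶠ v | a ≟ᶠ v
    ...   | yes refl | _        = ⊥-elim (¬Reach-delete-from G b≢v cb)
    ...   | no c≢v   | yes refl = inj₂ (Reach-sym Gv cb ◅◅ linked (E-sym G e))
    ...   | no c≢v   | no a≢v   = inj₁ ((e , a≢v , c≢v) ◅ cb)

  neighbours-linked⇒¬IsCutVertex : ¬ IsCutVertex G v
  neighbours-linked⇒¬IsCutVertex (_ , x , y , _ , _ , x≢v , y≢v , xy , ¬xy)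
    with avoids-v-or-reaches-h xy y≢v | avoids-v-or-reaches-h (Reach-sym G xy) x≢v
  ... | inj₁ p  | _       = ¬xy p
  ... | _       | inj₁ p  = ¬xy (Reach-sym Gv p)
  ... | inj₂ yh | inj₂ xh = ¬xy (xh ◅◅ Reach-sym Gv yh)

module _ {n} {B : SGraph n} {m} {cyc : Fin (suc m) → Fin n} (H : HamCycle B m cyc) where
  open HamCycle H

  distinct-vertices≤cycle-length : ∀ {k} (xs : Fin k → Fin n) → Injective _≡_ _≡_ xs →
    (∀ i → V B (xs i)) → k ≤ suc m
  distinct-vertices≤cycle-length xs xs-inj xs∈B = injective⇒≤ index-injective
    where
    index : Fin _ → Fin (suc m)
    index i = proj₁ (onto (xs i) (xs∈B i))

    index-injective : Injective _≡_ _≡_ index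
    index-injective {i} {j} eq = xs-inj (begin
      xs i              ≡⟨ sym (proj₂ (onto (xs i) (xs∈B i))) ⟩
      cyc (index i)     ≡⟨ cong cyc eq ⟩
      cyc (index j)     ≡⟨ proj₂ (onto (xs j) (xs∈B j)) ⟩
      xs j              ∎)
      where open ≡-Reasoning

  nontrivial-cycle-length : Nontrivial B → 3 ≤ suc m
  nontrivial-cycle-length (x , y , z , x∈B , y∈B , z∈B , x≢y , y≢z , x≢z) =
    distinct-vertices≤cycle-length corner corner-injective corner∈B
    where
    corner : Fin 3 → Fin n
    corner fzero               = x
    corner (fsuc fzero)        = y
    corner (fsuc (fsuc fzero)) = z

    corner∈B : ∀ i → V B (corner i)
    corner∈B fzero               = x∈B
    corner∈B (fsuc fzero)        = y∈B
    corner∈B (fsuc (fsuc fzero)) = z∈B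

    corner-injective : Injective _≡_ _≡_ corner
    corner-injective {fzero}               {fzero}               _ = refl
    corner-injective {fsuc fzero}          {fsuc fzero}          _ = refl
    corner-injective {fsuc (fsuc fzero)}   {fsuc (fsuc fzero)}   _ = refl
    corner-injective {fzero}               {fsuc fzero}          e = contradiction e x≢y
    corner-injective {fsuc fzero}          {fzero}               e = contradiction (sym e) x≢y
    corner-injective {fsuc fzero}          {fsuc (fsuc fzero)}   e = contradiction e y≢z
    corner-injective {fsuc (fsuc fzero)}   {fsuc fzero}          e = contradiction (sym e) y≢z
    corner-injective {fzero}               {fsuc (fsuc fzero)}   e = contradiction e x≢z
    corner-injective {fsuc (fsuc fzero)}   {fzero}               e = contradiction (sym e) x≢z

module _ {n} {B : SGraph n} {m} {cyc : Fin (suc (suc m)) → Fin n} (H : HamCycle B (suc m) cyc) where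
  open HamCycle H

  avoids-start : ∀ i → cyc (fsuc i) ≢ cyc fzero
  avoids-start i eq with inj _ _ eq
  ... | ()

  arc-avoiding-start : ∀ {G} → B ⊆G G →
    Reach (delete G (cyc fzero)) (cyc (fsuc fzero)) (cyc (fromℕ (suc m)))
  arc-avoiding-start B⊆G =
    chain (cyc ∘ fsuc) (λ i → proj₂ B⊆G _ _ (step (fsuc i)) , avoids-start _ , avoids-start _)

-- Consecutive σ a b unfolds to CyclicNeighbours n (pos a) (pos b).
CyclicNeighbours : ℕ → ℕ → ℕ → Set
CyclicNeighbours n p q = suc p ≡ q ⊎ suc q ≡ p ⊎ (p ≡ 0 × suc q ≡ n) ⊎ (q ≡ 0 × suc p ≡ n)

-- The four linear orders of positions that are cyclically in the order p, a, z, b.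
CyclicallyOrdered : ℕ → ℕ → ℕ → ℕ → Set
CyclicallyOrdered p a z b = (p < a × a < z × z < b) ⊎ (b < p × p < a × a < z) ⊎
                           (z < b × b < p × p < a) ⊎ (a < z × z < b × b < p)

-- Cutting the circle of n positions open at p: every other position m is read as a
-- number strictly between p and p + n, in the order met when walking on from p.
module Unrolling (n p : ℕ) where

  unroll : ℕ → ℕ
  unroll m with p <? m
  ... | yes _ = m
  ... | no  _ = m + n

  unroll-injective : ∀ {a b} → a < n → b < n → unroll a ≡ unroll b → a ≡ b
  unroll-injective {a} {b} a<n b<n eq with p <? a | p <? b
  ... | yes _ | yes _ = eq
  ... | yes _ | no  _ = contradiction eq (<⇒≢ (<-≤-trans a<n (m≤n+m n b)))
  ... | no  _ | yes _ = contradiction (sym eq) (<⇒≢ (<-≤-trans b<n (m≤n+m n a)))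
  ... | no  _ | no  _ = +-cancelʳ-≡ n a b eq

  unroll-bounds : ∀ {m} → p < n → m < n → m ≢ p → p < unroll m × unroll m < p + n
  unroll-bounds {m} p<n m<n m≢p with p <? m
  ... | yes p<m = p<m , <-≤-trans m<n (m≤n+m n p)
  ... | no  p≮m = <-≤-trans p<n (m≤n+m n m) , +-monoˡ-< n (≤∧≢⇒< (≮⇒≥ p≮m) m≢p)

  unroll-neighbour : ∀ {q} → q ≢ p → CyclicNeighbours n p q →
    unroll q ≡ suc p ⊎ suc (unroll q) ≡ p + n
  unroll-neighbour {q} q≢p adj with p <? q | adj
  ... | yes _   | inj₁ sp≡q                    = inj₁ (sym sp≡q)
  ... | no  p≮q | inj₁ sp≡q                    = contradiction (≤-reflexive sp≡q) p≮q
  ... | yes p<q | inj₂ (inj₁ sq≡p)             = contradiction p<q (<-asym (≤-reflexive sq≡p))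
  ... | no  _   | inj₂ (inj₁ sq≡p)             = inj₂ (cong (_+ n) sq≡p)
  ... | yes _   | inj₂ (inj₂ (inj₁ (p≡0 , sq≡n))) = inj₂ (trans sq≡n (cong (_+ n) (sym p≡0)))
  ... | no  p≮q | inj₂ (inj₂ (inj₁ (p≡0 , _)))  =
    contradiction (≤-antisym (≮⇒≥ p≮q) (subst (_≤ q) (sym p≡0) z≤n)) q≢p
  ... | yes p<q | inj₂ (inj₂ (inj₂ (q≡0 , _)))  = contradiction (subst (p <_) q≡0 p<q) λ ()
  ... | no  _   | inj₂ (inj₂ (inj₂ (q≡0 , sp≡n))) = inj₁ (trans (cong (_+ n) q≡0) (sym sp≡n))

  unroll-cyclicallyOrdered : ∀ {a z b} → z < n → b < n → b ≢ p →
    unroll a < unroll z → unroll z < unroll b → CyclicallyOrdered p a z b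
  unroll-cyclicallyOrdered {a} {z} {b} z<n b<n b≢p a<z z<b with p <? a | p <? z | p <? b
  ... | yes p<a | yes _ | yes _ = inj₁ (p<a , a<z , z<b)
  ... | yes p<a | yes _ | no p≮b = inj₂ (inj₁ (≤∧≢⇒< (≮⇒≥ p≮b) b≢p , p<a , a<z))
  ... | yes p<a | no  _ | no p≮b =
    inj₂ (inj₂ (inj₁ (+-cancelʳ-< n z b z<b , ≤∧≢⇒< (≮⇒≥ p≮b) b≢p , p<a)))
  ... | no  _   | no  _ | no p≮b =
    inj₂ (inj₂ (inj₂ (+-cancelʳ-< n a z a<z , +-cancelʳ-< n z b z<b , ≤∧≢⇒< (≮⇒≥ p≮b) b≢p)))
  ... | _       | no  _ | yes _ = contradiction (<-≤-trans b<n (m≤n+m n z)) (<-asym z<b)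
  ... | no  _   | yes _ | _     = contradiction (<-≤-trans z<n (m≤n+m n a)) (<-asym a<z)

module _ {n} (G′ : SGraph n) (σ : Permutation′ n) where

  pos : Fin n → ℕ
  pos x = toℕ (σ ⟨$⟩ʳ x)

  pos-injective : ∀ {x y} → pos x ≡ pos y → x ≡ y
  pos-injective {x} {y} eq = begin
    x                       ≡⟨ sym (inverseˡ σ) ⟩
    σ ⟨$⟩ˡ (σ ⟨$⟩ʳ x)        ≡⟨ cong (σ ⟨$⟩ˡ_) (toℕ-injective eq) ⟩
    σ ⟨$⟩ˡ (σ ⟨$⟩ʳ y)        ≡⟨ inverseˡ σ ⟩
    y                       ∎
    where open ≡-Reasoning

  Consecutive? : ∀ a b → Dec (Consecutive σ a b)
  Consecutive? a b = (suc (pos a) ≟ pos b) ⊎-dec (suc (pos b) ≟ pos a) ⊎-dec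
                     ((pos a ≟ 0) ×-dec (suc (pos b) ≟ n)) ⊎-dec ((pos b ≟ 0) ×-dec (suc (pos a) ≟ n))

  internal-or-consecutive : ∀ {a b} → E G′ a b → InternalEdge G′ σ a b ⊎ Consecutive σ a b
  internal-or-consecutive {a} {b} ab with Consecutive? a b
  ... | yes c = inj₂ c
  ... | no ¬c = inj₁ (ab , ¬c)

  module _ (op : OuterplanarOrder G′ σ) where

    interleaved-edges-cross : ∀ {v z a b} → E G′ v z → E G′ a b →
      ¬ CyclicallyOrdered (pos v) (pos a) (pos z) (pos b)
    interleaved-edges-cross {v} {z} {a} {b} vz ab (inj₁ c)               = op v z a b vz ab c
    interleaved-edges-cross {v} {z} {a} {b} vz ab (inj₂ (inj₁ c))        = op b a v z (E-sym G′ ab) vz c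
    interleaved-edges-cross {v} {z} {a} {b} vz ab (inj₂ (inj₂ (inj₁ c))) = op z v b a (E-sym G′ vz) (E-sym G′ ab) c
    interleaved-edges-cross {v} {z} {a} {b} vz ab (inj₂ (inj₂ (inj₂ c))) = op a b z v ab (E-sym G′ vz) c

    module _ (v : Fin n) where
      open Unrolling n (pos v)

      key : Fin n → ℕ
      key x = unroll (pos x)

      key-injective : ∀ {x y} → key x ≡ key y → x ≡ y
      key-injective {x} {y} = pos-injective ∘ unroll-injective (toℕ<n (σ ⟨$⟩ʳ x)) (toℕ<n (σ ⟨$⟩ʳ y))

      walk-around-v-visits-neighbours : ∀ {R : Fin n → Fin n → Set} →
        (∀ {x y} → R x y → E G′ x y × x ≢ v × y ≢ v) →
        ∀ {a b} → Star R a b → key a ≡ suc (pos v) → suc (key b) ≡ pos v + n →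
        ∀ {z} → E G′ z v → Star R a z
      walk-around-v-visits-neighbours {R} edge {a} {b} walk ka kb {z} zv with z ≟ᶠ a | z ≟ᶠ b
      ... | yes refl | _        = ε
      ... | no _     | yes refl = walk
      ... | no z≢a   | no z≢b
        with intermediate-value key (key z) walk a<z z<b
        where
        z≢v : z ≢ v
        z≢v z≡v = E-irr G′ (subst (λ x → E G′ x v) z≡v zv)

        bounds = unroll-bounds (toℕ<n (σ ⟨$⟩ʳ v)) (toℕ<n (σ ⟨$⟩ʳ z)) (z≢v ∘ pos-injective)

        a<z : key a < key z
        a<z = ≤∧≢⇒< (subst (_≤ key z) (sym ka) (proj₁ bounds)) (z≢a ∘ sym ∘ key-injective)

        z<b : key z < key b
        z<b = ≤∧≢⇒< (≤-pred (subst (key z <_) (sym kb) (proj₂ bounds))) (z≢b ∘ key-injective)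
      ... | inj₁ (c , kc≡kz , prefix) = subst (Star R a) (key-injective kc≡kz) prefix
      ... | inj₂ (x , y , r , x<z , z<y) =
        let (xy , _ , y≢v) = edge r in
        ⊥-elim (interleaved-edges-cross (E-sym G′ zv) xy
          (unroll-cyclicallyOrdered (toℕ<n (σ ⟨$⟩ʳ z)) (toℕ<n (σ ⟨$⟩ʳ y)) (y≢v ∘ pos-injective) x<z z<y))

      module _ {G : SGraph n} (G⊆G′ : G ⊆G G′) where
        private
          Gv = delete G v

          edge : ∀ {x y} → E Gv x y → E G′ x y × x ≢ v × y ≢ v
          edge (xy , x≢v , y≢v) = proj₂ G⊆G′ _ _ xy , x≢v , y≢v

          linked-to : ∀ {a b} → Star (E Gv) a b → key a ≡ suc (pos v) → suc (key b) ≡ pos v + n →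
            ∀ {z} → E G z v → Reach Gv z a
          linked-to walk ka kb = Reach-sym Gv ∘ walk-around-v-visits-neighbours edge walk ka kb ∘ proj₂ G⊆G′ _ _

        boundary-neighbours-linked⇒¬IsCutVertex : ∀ {u w} →
          Consecutive σ v u → Consecutive σ v w → u ≢ w → u ≢ v → w ≢ v →
          Reach Gv u w → ¬ IsCutVertex G v
        boundary-neighbours-linked⇒¬IsCutVertex vu vw u≢w u≢v w≢v walk
          with unroll-neighbour (u≢v ∘ pos-injective) vu | unroll-neighbour (w≢v ∘ pos-injective) vw
        ... | inj₁ ku | inj₁ kw = contradiction (key-injective (trans ku (sym kw))) u≢w
        ... | inj₂ ku | inj₂ kw = contradiction (key-injective (suc-injective (trans ku (sym kw)))) u≢w
        ... | inj₁ ku | inj₂ kw = neighbours-linked⇒¬IsCutVertex G v _ (linked-to walk ku kw)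
        ... | inj₂ ku | inj₁ kw = neighbours-linked⇒¬IsCutVertex G v _ (linked-to (Reach-sym Gv walk) kw ku)

lemma1 : ∀ {n : ℕ} (G′ : SGraph n) (S : Fin n → Set) →
    (∀ x → V G′ x) → Biconnected G′ →
    (σ : Permutation′ n) → OuterplanarOrder G′ σ →
    Outerplanar (Induced G′ S) →
    (v : Fin n) → IsCutVertex (Induced G′ S) v →
    (B : SGraph n) → IsBlock (Induced G′ S) B → Nontrivial B → V B v →
    (k : ℕ) (cyc : Fin (suc (suc k)) → Fin n) → HamCycle B (suc k) cyc →
    cyc fzero ≡ v →
    InternalEdge G′ σ v (cyc (fsuc fzero)) ⊎ InternalEdge G′ σ v (cyc (fromℕ (suc k)))
lemma1 _ _ _ _ _ _ _ _ _ B _ nontrivial _ zero _ H _ with nontrivial-cycle-length H nontrivial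
... | s≤s (s≤s ())
lemma1 G′ S _ _ σ op _ .(cyc fzero) cut B blk _ _ (suc k) cyc H refl =
  one-internal (internal-or-consecutive G′ σ (B-edge (step fzero)))
               (internal-or-consecutive G′ σ (E-sym G′ (B-edge close)))
  where
  open HamCycle H
  v = cyc fzero
  u = cyc (fsuc fzero)
  w = cyc (fromℕ (suc (suc k)))

  B-edge : ∀ {a b} → E B a b → E G′ a b
  B-edge {a} {b} = proj₂ (Induced-⊆ G′ S) a b ∘ proj₂ (proj₁ blk) a b

  one-internal : InternalEdge G′ σ v u ⊎ Consecutive σ v u → InternalEdge G′ σ v w ⊎ Consecutive σ v w →
    InternalEdge G′ σ v u ⊎ InternalEdge G′ σ v w
  one-internal (inj₁ vu) _ = inj₁ vu
  one-internal (inj₂ _) (inj₁ vw) = inj₂ vw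
  one-internal (inj₂ vu) (inj₂ vw) =
    ⊥-elim (boundary-neighbours-linked⇒¬IsCutVertex G′ σ op v {Induced G′ S} (Induced-⊆ G′ S) {u} {w} vu vw
      (λ u≡w → contradiction (inj _ _ u≡w) λ ()) (avoids-start H _) (avoids-start H _)
      (arc-avoiding-start H {Induced G′ S} (proj₁ blk)) cut)
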